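{- Let $q$ be a prime power, $X=\mathbb{Z}_{q^2+q+1}$ and $\mathcal{G}_0\subseteq X$ the Singer Sidon set. If $P$ is the set of absolute vertices of the sum graph $G_{X,\mathcal{G}_0}$, then $|P|=q+1$.
   Context: Singer set: let $\theta$ be a primitive element of $\mathbb{F}_{q^3}$ and $\mathcal{B}=\{\log_\theta(\theta+a): a\in\mathbb{F}_q\}\subseteq\mathbb{Z}_{q^3-1}$, where $\log_\theta(x)$ is the unique $k\in\mathbb{Z}_{q^3-1}$ with $\theta^k=x$. Let $\mathcal{G}$ be the image of $\mathcal{B}$ under reduction $\mathbb{Z}_{q^3-1}\to\mathbb{Z}_{q^2+q+1}$ (note $q^2+q+1\mid q^3-1$), and $\mathcal{G}_0=\mathcal{G}\cup\{0\}$; this is a Sidon set in $\mathbb{Z}_{q^2+q+1}$ with $q+1$ elements. The sum graph $G_{X,\mathcal{A}}$ has vertex set $X$, distinct $x,y$ adjacent iff $x+y\in\mathcal{A}$; a vertex $z$ is absolute if $z+z\in\mathcal{A}$. -}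

module Defs where

open import Level using (Level; _⊔_)
open import Data.Nat using (ℕ; zero; suc; _+_; _*_; _^_; _≥_; _%_)
open import Data.Nat.DivMod using (m%n<n)
open import Data.Nat.Primality using (Prime)
open import Data.Fin using (Fin; toℕ; fromℕ<)
open import Data.Product using (Σ; ∃; _×_)
open import Data.Sum using (_⊎_)
open import Relation.Nullary using (¬_)
open import Relation.Binary.PropositionalEquality using (_≡_; setoid)
open import Algebra.Bundles using (CommutativeRing)
open import Algebra.Morphism.Structures using (module RingMorphisms)
open import Function.Bundles using (Inverse)

IsPrimePower : ℕ → Set
IsPrimePower q = Σ ℕ λ p → Σ ℕ λ k → Prime p × k ≥ 1 × q ≡ p ^ k

IsField : ∀ {c ℓ} → CommutativeRing c ℓ → Set (c ⊔ ℓ)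
IsField R = ¬ (1# ≈ 0#) × (∀ x → ¬ (x ≈ 0#) → ∃ λ y → x *ᴿ y ≈ 1#)
  where open CommutativeRing R using (_≈_; 0#; 1#) renaming (_*_ to _*ᴿ_)

HasCard : ∀ {c ℓ} → CommutativeRing c ℓ → ℕ → Set (c ⊔ ℓ)
HasCard R m = Inverse (setoid (Fin m)) (CommutativeRing.setoid R)

pow : ∀ {c ℓ} (R : CommutativeRing c ℓ) → CommutativeRing.Carrier R → ℕ → CommutativeRing.Carrier R
pow R x zero    = CommutativeRing.1# R
pow R x (suc k) = CommutativeRing._*_ R x (pow R x k)

IsPrimitive : ∀ {c ℓ} (R : CommutativeRing c ℓ) → CommutativeRing.Carrier R → Set (c ⊔ ℓ)
IsPrimitive R θ = ∀ x → ¬ (x ≈ 0#) → ∃ λ k → pow R θ k ≈ x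
  where open CommutativeRing R using (_≈_; 0#)

IsEmbedding : ∀ {c ℓ c' ℓ'} (F : CommutativeRing c ℓ) (K : CommutativeRing c' ℓ')
  → (CommutativeRing.Carrier F → CommutativeRing.Carrier K) → Set (c ⊔ ℓ ⊔ ℓ')
IsEmbedding F K ι = RingMorphisms.IsRingMonomorphism (CommutativeRing.rawRing F) (CommutativeRing.rawRing K) ι

-- The modulus n = q^2 + q + 1 (written as a successor so that NonZero is automatic).
modulus : ℕ → ℕ
modulus q = suc (q * q + q)

_+[_]_ : ∀ {n'} → Fin (suc n') → (n : ℕ) → Fin (suc n') → Fin (suc n')
_+[_]_ {n'} x _ y = fromℕ< (m%n<n (toℕ x + toℕ y) (suc n'))

SumAdj : ∀ {a n'} → (Fin (suc n') → Set a) → Fin (suc n') → Fin (suc n') → Set a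
SumAdj {n' = n'} A x y = ¬ (x ≡ y) × A (x +[ suc n' ] y)

IsAbsolute : ∀ {a n'} → (Fin (suc n') → Set a) → Fin (suc n') → Set a
IsAbsolute {n' = n'} A z = A (z +[ suc n' ] z)

-- The Singer set G_0 ⊆ ℤ_{q^2+q+1}, for the field K = F_{q^3} with subfield
-- ι(F_q) and primitive element θ:
--   B = { log_θ(θ + ι a) : a ∈ F_q } ⊆ ℤ_{q^3-1},  G = B mod (q^2+q+1),  G_0 = G ∪ {0}.
-- r ∈ G iff r is the residue mod q^2+q+1 of some exponent k with θ^k = θ + ι a
-- (this residue does not depend on the chosen representative k of log_θ, since
-- q^2+q+1 divides q^3-1, the order of θ).
SingerG0 : ∀ {c ℓ c' ℓ'} (q : ℕ) (F : CommutativeRing c ℓ) (K : CommutativeRing c' ℓ')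
  → (CommutativeRing.Carrier F → CommutativeRing.Carrier K) → CommutativeRing.Carrier K
  → Fin (modulus q) → Set (c ⊔ ℓ')
SingerG0 q F K ι θ r =
  toℕ r ≡ 0 ⊎
  (Σ (CommutativeRing.Carrier F) λ a → Σ ℕ λ k →
     (pow K θ k ≈ θ +ᴷ ι a) × (k % modulus q ≡ toℕ r))
  where open CommutativeRing K using (_≈_) renaming (_+_ to _+ᴷ_)

module Submission where

open import Defs
open import Data.Nat using (ℕ; suc; _^_)
open import Data.Fin using (Fin)
open import Data.Fin.Subset using (Subset; _∈_; ∣_∣)
open import Data.Product using (Σ; _×_)
open import Function.Bundles using (_⇔_)
open import Relation.Binary.PropositionalEquality using (_≡_)
open import Algebra.Bundles using (CommutativeRing)

import Data.Nat as ℕ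
import Data.Fin as Fin
open import Data.Fin using (toℕ; fromℕ<)
import Relation.Binary.PropositionalEquality as ≡
open ≡ using (_≢_)
open import Level using (_⊔_)
open import Data.Nat using (NonZero)
open import Data.Nat.Divisibility using (_∣_; divides; n∣m*n; ∣-trans; ∣-refl; ∣-reflexive; ∣⇒≤)
open import Data.Nat.DivMod using (m≡m%n+[m/n]*n; m%n<n; m<n⇒m%n≡m; m%n*o≡m*o%[n*o])
open import Data.Nat.Tactic.RingSolver using (solve-∀)
open import Data.Fin.Properties using (toℕ<n; toℕ-injective; toℕ-fromℕ<; fromℕ<-injective; pigeonhole; injective⇒≤; any?)
open import Data.Product using (∃; _,_; proj₁; proj₂)
open import Data.Sum using (_⊎_; inj₁; inj₂; [_,_]′)
open import Data.Empty using (⊥-elim)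
open import Function using (_∘_)
open import Function.Bundles using (mk⇔; Equivalence; Inverse)
open import Function.Definitions using (Injective)
open import Relation.Nullary using (¬_; Dec; yes; no; map′; contradiction)
open import Relation.Unary using (Decidable)
open import Algebra.Bundles using (Ring)
open import Algebra.Morphism.Structures using (module RingMorphisms)
import Function.Properties.Equivalence as ⇔

-- Let θ be a primitive element of K = F_{q³} and ι : F_q → K the embedding. For a
-- multiplicative subgroup S of K*, the exponents k with θ^k ∈ S are closed under sums and
-- differences, hence are the multiples of their least positive element (NatLemmas.ExponentSet,
-- PrimitiveElement.Exponents). For S = {1} this period is the order of θ, which counting
-- shows is q³ - 1 (PrimitiveElement.order≡M). For S = ι(F_q)*, counting ι(F_q)* as the
-- powers θ^(j·d) shows q³ - 1 = (q - 1)·d, so the period is d = n (Subfield.period≡n).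
-- Consequently θ ∉ ι(F_q), 1 and θ are linearly independent over ι(F_q), and the residues
-- mod n of the logarithms of θ + ι a (a ∈ F_q) are nonzero, pairwise distinct and do not
-- depend on the chosen logarithm: G₀ has exactly q + 1 points, enumerated by singerPoint.
-- Finally n is odd, so doubling is a bijection of ℤ_n (Halving); the absolute vertices
-- {z : 2z ∈ G₀} are therefore the image of the injection half ∘ singerPoint, which has
-- q + 1 elements (ImageCounting).

module NatLemmas where
  open import Data.Nat using (zero; _+_; _*_; _∸_; _%_; _/_; _<_; _≤_; s≤s⁻¹)
  open import Data.Nat.Properties using (n<1+n; m<1+n⇒m<n∨m≡n; +-comm; suc-pred; m+[n∸m]≡n; *-cancelʳ-≡; *-monoˡ-<)
  open import Data.Nat.DivMod using ([m+kn]%n≡m%n)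
  open import Data.Nat.Divisibility using (m%n≡0⇒n∣m)
  open ≡ using (refl; sym; trans; subst; cong; module ≡-Reasoning)

  %-congruent : ∀ {i j d} .{{_ : NonZero d}} → j ≤ i → d ∣ i ∸ j → i % d ≡ j % d
  %-congruent {i} {j} {d} j≤i (divides c i∸j≡cd) = begin
    i % d                 ≡⟨ cong (_% d) (m+[n∸m]≡n j≤i) ⟨
    (j + (i ∸ j)) % d     ≡⟨ cong (λ x → (j + x) % d) i∸j≡cd ⟩
    (j + c * d) % d       ≡⟨ [m+kn]%n≡m%n j c d ⟩
    j % d                 ∎
    where open ≡-Reasoning

  multiples-injective : ∀ {t d i j} .{{_ : NonZero d}} .{{_ : NonZero (t * d)}} → i < t → j < t →
                        i * d % (t * d) ≡ j * d % (t * d) → i ≡ j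
  multiples-injective {t} {d} {i} {j} i<t j<t eq = *-cancelʳ-≡ i j d (begin
    i * d               ≡⟨ m<n⇒m%n≡m (*-monoˡ-< d i<t) ⟨
    i * d % (t * d)     ≡⟨ eq ⟩
    j * d % (t * d)     ≡⟨ m<n⇒m%n≡m (*-monoˡ-< d j<t) ⟩
    j * d               ∎)
    where open ≡-Reasoning

  least-below : ∀ {p} {P : ℕ → Set p} → Decidable P → ∀ b →
    (∃ λ d → P d × ∀ k → k < d → ¬ P k) ⊎ (∀ k → k < b → ¬ P k)
  least-below P? zero = inj₂ λ _ ()
  least-below P? (suc b) with least-below P? b
  ... | inj₁ found = inj₁ found
  ... | inj₂ none with P? b
  ...   | yes Pb  = inj₁ (b , Pb , none)
  ...   | no  ¬Pb = inj₂ λ k k<1+b → [ none k , (λ { refl → ¬Pb }) ]′ (m<1+n⇒m<n∨m≡n k<1+b)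

  least : ∀ {p} {P : ℕ → Set p} → Decidable P → ∀ {m} → P m → ∃ λ d → P d × ∀ k → k < d → ¬ P k
  least P? {m} Pm with least-below P? (suc m)
  ... | inj₁ found = found
  ... | inj₂ none  = ⊥-elim (none m (n<1+n m) Pm)

  -- A set of exponents containing 0, closed under addition and under
  -- "subtraction" (a + b and a in P give b in P), is the set of multiples
  -- of its least positive element, provided it has a positive element.
  module ExponentSet {p} (P : ℕ → Set p) (P? : Decidable P) (P-zero : P 0)
    (P-+ : ∀ {a b} → P a → P b → P (a + b)) (P-∸ : ∀ {a b} → P (a + b) → P a → P b) where

    P-multiple : ∀ {d} → P d → ∀ j → P (j * d)
    P-multiple Pd zero    = P-zero
    P-multiple Pd (suc j) = P-+ Pd (P-multiple Pd j)

    record Generator : Set p where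
      field
        period          : ℕ
        {{period≢0}}    : NonZero period
        period∈P        : P period
        period-divides  : ∀ {k} → P k → period ∣ k

      multiple∈P : ∀ {k} → period ∣ k → P k
      multiple∈P (divides j refl) = P-multiple period∈P j

    -- The least positive element d of P generates P: writing k = (k / d) * d + k % d,
    -- k % d ∈ P, and the minimality of d forces k % d = 0.
    least-generates : ∀ d-1 → P (suc d-1) → (∀ k → k < d-1 → ¬ P (suc k)) → Generator
    least-generates d-1 Pd minimal =
      record { period = suc d-1 ; period∈P = Pd ; period-divides = d-divides }
      where
      d : ℕ
      d = suc d-1
      d-divides : ∀ {k} → P k → d ∣ k
      d-divides {k} Pk = m%n≡0⇒n∣m k d (remainder-zero (k % d) refl)
        where
        P-rem : P (k % d)
        P-rem = P-∸ (subst P (trans (m≡m%n+[m/n]*n k d) (+-comm (k % d) _)) Pk) (P-multiple Pd (k / d))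
        remainder-zero : ∀ r → k % d ≡ r → r ≡ 0
        remainder-zero zero    _  = refl
        remainder-zero (suc r) eq = ⊥-elim (minimal r (s≤s⁻¹ (subst (_< d) eq (m%n<n k d))) (subst P eq P-rem))

    -- A generator exists as soon as P has a positive element. (Opaque: only the
    -- fields of the generator matter, not how the search found it.)
    opaque
      generator : ∀ {m} .{{_ : NonZero m}} → P m → Generator
      generator {m} Pm with least (λ k → P? (suc k)) (subst P (sym (suc-pred m)) Pm)
      ... | d-1 , Pd , minimal = least-generates d-1 Pd minimal

  -- q² + q is even: it is twice the triangular number 1 + 2 + … + q.
  triangle : ℕ → ℕ
  triangle zero    = 0
  triangle (suc k) = suc k + triangle k

  triangle-double : ∀ k → k * k + k ≡ triangle k + triangle k
  triangle-double zero    = refl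
  triangle-double (suc k) = begin
    suc k * suc k + suc k                      ≡⟨ expand-square k ⟩
    (k * k + k) + (suc k + suc k)              ≡⟨ cong (_+ (suc k + suc k)) (triangle-double k) ⟩
    (triangle k + triangle k) + (suc k + suc k) ≡⟨ regroup k (triangle k) ⟩
    (suc k + triangle k) + (suc k + triangle k) ∎
    where
    open ≡-Reasoning
    expand-square : ∀ k → suc k * suc k + suc k ≡ (k * k + k) + (suc k + suc k)
    expand-square = solve-∀
    regroup : ∀ k t → (t + t) + (suc k + suc k) ≡ (suc k + t) + (suc k + t)
    regroup = solve-∀

open NatLemmas

-- Halving in ℤ_n for odd n = 2w + 1 (n = suc n'): doubling z ↦ z + z is a
-- bijection of Fin n, with inverse r ↦ (w + 1)·r, since 2(w + 1) = n + 1.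
module Halving (n' w : ℕ) (n'≡w+w : n' ≡ w ℕ.+ w) where
  open import Data.Nat using (_+_; _*_; _%_)
  open import Data.Nat.DivMod using ([m+kn]%n≡m%n; %-distribˡ-+; %-distribˡ-*; m%n%n≡m%n)
  open import Data.Nat.Properties using (*-distribʳ-+)
  open ≡ using (sym; trans; cong; module ≡-Reasoning)

  private
    n : ℕ
    n = suc n'

  double : Fin n → Fin n
  double z = z +[ n ] z

  half : Fin n → Fin n
  half r = fromℕ< (m%n<n (toℕ r * suc w) n)

  twice-inverse : ∀ x → (x * suc w + x * suc w) % n ≡ x % n
  twice-inverse x = trans (cong (_% n) (trans (expand x w) (cong (λ m → x + x * suc m) (sym n'≡w+w))))
                          ([m+kn]%n≡m%n x x n)
    where
    expand : ∀ x w → x * suc w + x * suc w ≡ x + x * suc (w + w)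
    expand = solve-∀

  %-*-absorbˡ : ∀ a b → (a % n * b) % n ≡ (a * b) % n
  %-*-absorbˡ a b = begin
    (a % n * b) % n              ≡⟨ %-distribˡ-* (a % n) b n ⟩
    (a % n % n * (b % n)) % n    ≡⟨ cong (λ m → (m * (b % n)) % n) (m%n%n≡m%n a n) ⟩
    (a % n * (b % n)) % n        ≡⟨ %-distribˡ-* a b n ⟨
    (a * b) % n                  ∎
    where open ≡-Reasoning

  double-half : ∀ r → double (half r) ≡ r
  double-half r = toℕ-injective (begin
    toℕ (double (half r))                        ≡⟨ toℕ-fromℕ< _ ⟩
    (h + h) % n                                  ≡⟨ cong (λ m → (m + m) % n) (toℕ-fromℕ< (m%n<n x n)) ⟩
    (x % n + x % n) % n                          ≡⟨ %-distribˡ-+ x x n ⟨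
    (x + x) % n                                  ≡⟨ twice-inverse (toℕ r) ⟩
    toℕ r % n                                    ≡⟨ m<n⇒m%n≡m (toℕ<n r) ⟩
    toℕ r                                        ∎)
    where
    open ≡-Reasoning
    x h : ℕ
    x = toℕ r * suc w
    h = toℕ (half r)

  half-double : ∀ z → half (double z) ≡ z
  half-double z = toℕ-injective (begin
    toℕ (half (double z))                        ≡⟨ toℕ-fromℕ< _ ⟩
    (toℕ (double z) * suc w) % n                 ≡⟨ cong (λ m → (m * suc w) % n) (toℕ-fromℕ< (m%n<n z+z n)) ⟩
    ((toℕ z + toℕ z) % n * suc w) % n            ≡⟨ %-*-absorbˡ (toℕ z + toℕ z) (suc w) ⟩
    ((toℕ z + toℕ z) * suc w) % n                ≡⟨ cong (_% n) (*-distribʳ-+ (suc w) (toℕ z) (toℕ z)) ⟩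
    (toℕ z * suc w + toℕ z * suc w) % n          ≡⟨ twice-inverse (toℕ z) ⟩
    toℕ z % n                                    ≡⟨ m<n⇒m%n≡m (toℕ<n z) ⟩
    toℕ z                                        ∎)
    where
    open ≡-Reasoning
    z+z : ℕ
    z+z = toℕ z + toℕ z

module ImageCounting where
  open import Data.Nat using (zero)
  open import Data.Fin using (zero; suc; _≟_)
  open import Data.Fin.Properties using (suc-injective; 0≢1+n)
  open import Data.Fin.Subset using (_∉_; _-_; inside; outside)
  open import Data.Fin.Subset.Properties using (p─⊥≡p; p─q⊆p; x∈p∧x≢y⇒x∈p-y; Empty-unique; ∣⊥∣≡0)
  open import Data.Vec using (_∷_; here; there; tabulate; lookup)
  open import Data.Vec.Properties using (lookup∘tabulate; []=⇒lookup; lookup⇒[]=)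
  open import Data.Bool.Properties using (T-≡)
  open import Relation.Nullary.Decidable using (isYes; toWitness; fromWitness)
  open ≡ using (refl; sym; trans; cong)

  image : ∀ {m n} → (Fin m → Fin n) → Subset n
  image e = tabulate λ z → isYes (any? λ i → e i ≟ z)

  IsImage : ∀ {m n} → Subset n → (Fin m → Fin n) → Set
  IsImage p e = ∀ z → z ∈ p ⇔ ∃ λ i → e i ≡ z

  image-isImage : ∀ {m n} (e : Fin m → Fin n) → IsImage (image e) e
  image-isImage e z = mk⇔
    (λ z∈ → toWitness {a? = hits?} (Equivalence.from T-≡ (trans (sym entry) ([]=⇒lookup z∈))))
    (λ hit → lookup⇒[]= z (image e) (trans entry (Equivalence.to T-≡ (fromWitness {a? = hits?} hit))))
    where
    hits? : Dec (∃ λ i → e i ≡ z)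
    hits? = any? λ i → e i ≟ z
    entry : lookup (image e) z ≡ isYes hits?
    entry = lookup∘tabulate (λ z → isYes (any? λ i → e i ≟ z)) z

  x∉p-x : ∀ {n} (p : Subset n) x → x ∉ p - x
  x∉p-x (_ ∷ p) zero    ()
  x∉p-x (_ ∷ p) (suc x) (there x∈) = x∉p-x p x x∈

  ∣p∣≡1+∣p-x∣ : ∀ {n} (p : Subset n) {x} → x ∈ p → ∣ p ∣ ≡ suc ∣ p - x ∣
  ∣p∣≡1+∣p-x∣ (inside ∷ p) here = cong suc (cong ∣_∣ (sym (p─⊥≡p p)))
  ∣p∣≡1+∣p-x∣ (inside ∷ p) (there x∈p) = cong suc (∣p∣≡1+∣p-x∣ p x∈p)
  ∣p∣≡1+∣p-x∣ (outside ∷ p) (there x∈p) = ∣p∣≡1+∣p-x∣ p x∈p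

  ∣image∣ : ∀ {m n} (p : Subset n) (e : Fin m → Fin n) → Injective _≡_ _≡_ e → IsImage p e → ∣ p ∣ ≡ m
  ∣image∣ {zero} {n} p e _ img = trans (cong ∣_∣ (Empty-unique noMember)) (∣⊥∣≡0 n)
    where
    noMember : ¬ ∃ λ z → z ∈ p
    noMember (z , z∈p) with () ← proj₁ (Equivalence.to (img z) z∈p)
  ∣image∣ {suc m} p e inj img =
    trans (∣p∣≡1+∣p-x∣ p e₀∈p) (cong suc (∣image∣ (p - e zero) (e ∘ suc) (suc-injective ∘ inj) rest))
    where
    e₀∈p : e zero ∈ p
    e₀∈p = Equivalence.from (img (e zero)) (zero , refl)
    rest : IsImage (p - e zero) (e ∘ suc)
    rest z = mk⇔ forward backward
      where
      forward : z ∈ p - e zero → ∃ λ j → e (suc j) ≡ z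
      forward z∈ with Equivalence.to (img z) (p─q⊆p p _ z∈)
      ... | zero  , refl = ⊥-elim (x∉p-x p (e zero) z∈)
      ... | suc j , ej≡z = j , ej≡z
      backward : (∃ λ j → e (suc j) ≡ z) → z ∈ p - e zero
      backward (j , ej≡z) = x∈p∧x≢y⇒x∈p-y (Equivalence.from (img z) (suc j , ej≡z))
        λ z≡e₀ → 0≢1+n (inj (trans (sym z≡e₀) (sym ej≡z)))

open ImageCounting

module FiniteRing {c ℓ} (R : CommutativeRing c ℓ) {m : ℕ} (card : HasCard R (ℕ.suc m)) where
  open CommutativeRing R
  open import Data.Fin.Properties using (punchOut-injective; punchIn-injective; punchInᵢ≢i)

  element : Fin (ℕ.suc m) → Carrier
  element = Inverse.to card

  index : Carrier → Fin (ℕ.suc m)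
  index = Inverse.from card

  element-index : ∀ x → element (index x) ≈ x
  element-index = Inverse.strictlyInverseˡ card

  index-injective : ∀ {x y} → index x ≡ index y → x ≈ y
  index-injective {x} {y} eq =
    trans (sym (element-index x)) (trans (reflexive (≡.cong element eq)) (element-index y))

  element-injective : ∀ {i j} → element i ≈ element j → i ≡ j
  element-injective {i} {j} eq =
    ≡.trans (≡.sym (Inverse.strictlyInverseʳ card i))
            (≡.trans (Inverse.from-cong card eq) (Inverse.strictlyInverseʳ card j))

  _≟_ : ∀ x y → Dec (x ≈ y)
  x ≟ y = map′ index-injective (Inverse.from-cong card) (index x Fin.≟ index y)

  any-element? : ∀ {p} (P : Carrier → Set p) → (∀ {x y} → x ≈ y → P x → P y) →
                 (∀ x → Dec (P x)) → Dec (∃ P)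
  any-element? P resp P? =
    map′ (λ (i , Pi) → element i , Pi)
         (λ (x , Px) → index x , resp (sym (element-index x)) Px)
         (any? (P? ∘ element))

  nonzero : Fin m → Carrier
  nonzero i = element (Fin.punchIn (index 0#) i)

  nonzero-≉0 : ∀ i → ¬ nonzero i ≈ 0#
  nonzero-≉0 i i≈0 = punchInᵢ≢i (index 0#) i
    (≡.trans (≡.sym (Inverse.strictlyInverseʳ card _)) (Inverse.from-cong card i≈0))

  nonzero-injective : ∀ {i j} → nonzero i ≈ nonzero j → i ≡ j
  nonzero-injective {i} {j} eq = punchIn-injective (index 0#) i j (element-injective eq)

  index≢index0 : ∀ {x} → ¬ x ≈ 0# → index 0# ≢ index x
  index≢index0 x≉0 = x≉0 ∘ index-injective ∘ ≡.sym

  index⁺ : ∀ x → ¬ x ≈ 0# → Fin m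
  index⁺ x x≉0 = Fin.punchOut (index≢index0 x≉0)

  index⁺-injective : ∀ {x y} (x≉0 : ¬ x ≈ 0#) (y≉0 : ¬ y ≈ 0#) → index⁺ x x≉0 ≡ index⁺ y y≉0 → x ≈ y
  index⁺-injective x≉0 y≉0 eq = index-injective (punchOut-injective (index≢index0 x≉0) (index≢index0 y≉0) eq)

  nonzero-count-≥ : ∀ {k} (f : Fin k → Carrier) → (∀ i → ¬ f i ≈ 0#) →
                    (∀ {i j} → f i ≈ f j → i ≡ j) → k ℕ.≤ m
  nonzero-count-≥ f f≉0 f-inj =
    injective⇒≤ λ {i} {j} eq → f-inj (index⁺-injective (f≉0 i) (f≉0 j) eq)

  nonzero-count-≤ : ∀ {k} (g : ∀ x → ¬ x ≈ 0# → Fin k) →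
                    (∀ {x y} x≉0 y≉0 → g x x≉0 ≡ g y y≉0 → x ≈ y) → m ℕ.≤ k
  nonzero-count-≤ g g-inj =
    injective⇒≤ λ {i} {j} eq → nonzero-injective (g-inj (nonzero-≉0 i) (nonzero-≉0 j) eq)

module PowerLaws {c ℓ} (R : CommutativeRing c ℓ) where
  open CommutativeRing R
  open import Algebra.Properties.Semiring.Exp semiring using (^-homo-*) renaming (_^_ to _^ᴿ_)

  pow≡^ : ∀ x k → pow R x k ≡ x ^ᴿ k
  pow≡^ x ℕ.zero  = ≡.refl
  pow≡^ x (suc k) = ≡.cong (x *_) (pow≡^ x k)

  pow-+ : ∀ x a b → pow R x (a ℕ.+ b) ≈ pow R x a * pow R x b
  pow-+ x a b rewrite pow≡^ x (a ℕ.+ b) | pow≡^ x a | pow≡^ x b = ^-homo-* x a b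

module RingLaws {c ℓ} (R : CommutativeRing c ℓ) where
  open CommutativeRing R
  open import Algebra.Properties.Group +-group using (//-rightDividesʳ)
  open import Relation.Binary.Reasoning.Setoid setoid

  +≈+⇒-≈- : ∀ {p q r s} → p + q ≈ r + s → p - r ≈ s - q
  +≈+⇒-≈- {p} {q} {r} {s} eq = begin
    p - r                 ≈⟨ +-congʳ (//-rightDividesʳ q p) ⟨
    ((p + q) - q) - r     ≈⟨ +-congʳ (+-congʳ eq) ⟩
    ((r + s) - q) - r     ≈⟨ +-congʳ (+-assoc r s (- q)) ⟩
    (r + (s - q)) - r     ≈⟨ +-congʳ (+-comm r (s - q)) ⟩
    ((s - q) + r) - r     ≈⟨ //-rightDividesʳ r (s - q) ⟩
    s - q                 ∎

module FieldLaws {c ℓ} (R : CommutativeRing c ℓ) (isField : IsField R) where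
  open CommutativeRing R
  open import Relation.Binary.Reasoning.Setoid setoid

  1≉0 : ¬ 1# ≈ 0#
  1≉0 = proj₁ isField

  inverse : ∀ x → ¬ x ≈ 0# → ∃ λ y → x * y ≈ 1#
  inverse = proj₂ isField

  *-cancelˡ : ∀ {x y z} → ¬ x ≈ 0# → x * y ≈ x * z → y ≈ z
  *-cancelˡ {x} {y} {z} x≉0 xy≈xz with inverse x x≉0
  ... | x⁻¹ , xx⁻¹≈1 = begin
    y                ≈⟨ *-identityˡ y ⟨
    1# * y           ≈⟨ *-congʳ (trans (*-comm x⁻¹ x) xx⁻¹≈1) ⟨
    (x⁻¹ * x) * y    ≈⟨ *-assoc x⁻¹ x y ⟩
    x⁻¹ * (x * y)    ≈⟨ *-congˡ xy≈xz ⟩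
    x⁻¹ * (x * z)    ≈⟨ *-assoc x⁻¹ x z ⟨
    (x⁻¹ * x) * z    ≈⟨ *-congʳ (trans (*-comm x⁻¹ x) xx⁻¹≈1) ⟩
    1# * z           ≈⟨ *-identityˡ z ⟩
    z                ∎

  *-≉0 : ∀ {x y} → ¬ x ≈ 0# → ¬ y ≈ 0# → ¬ x * y ≈ 0#
  *-≉0 {x} x≉0 y≉0 xy≈0 = y≉0 (*-cancelˡ x≉0 (trans xy≈0 (sym (zeroʳ x))))

  pow-≉0 : ∀ {x} k → ¬ x ≈ 0# → ¬ pow R x k ≈ 0#
  pow-≉0 ℕ.zero  x≉0 = 1≉0
  pow-≉0 (suc k) x≉0 = *-≉0 x≉0 (pow-≉0 k x≉0)

module PrimitiveElement {c ℓ} (K : CommutativeRing c ℓ) (isField : IsField K)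
  {M : ℕ} (card : HasCard K (suc M)) (1<M : 1 ℕ.< M)
  (θ : CommutativeRing.Carrier K) (θ-primitive : IsPrimitive K θ) where

  open import Data.Nat.Properties using (≤-total; ≤-antisym; m+[n∸m]≡n; <⇒≱; <⇒≤; n<1+n; +-suc; m≤n⇒∃[o]m+o≡n)
  open CommutativeRing K
  open FiniteRing K card
  open FieldLaws K isField
  open PowerLaws K
  open import Relation.Binary.Reasoning.Setoid setoid

  infix 8 θ^_
  θ^_ : ℕ → Carrier
  θ^ k = pow K θ k

  -- θ ≉ 0: otherwise every nonzero element, being a power of θ, equals 1,
  -- so K would have at most one nonzero element.
  θ≉0 : ¬ θ ≈ 0#
  θ≉0 θ≈0 = <⇒≱ 1<M (nonzero-count-≤ (λ _ _ → Fin.zero) λ x≉0 y≉0 _ →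
                          trans (is-one _ x≉0) (sym (is-one _ y≉0)))
    where
    is-one : ∀ x → ¬ x ≈ 0# → x ≈ 1#
    is-one x x≉0 with θ-primitive x x≉0
    ... | ℕ.zero , 1≈x = sym 1≈x
    ... | suc k , θ^1+k≈x = ⊥-elim (x≉0 (trans (sym θ^1+k≈x) (trans (*-congʳ θ≈0) (zeroˡ _))))

  θ^-≉0 : ∀ k → ¬ θ^ k ≈ 0#
  θ^-≉0 k = pow-≉0 k θ≉0

  -- The discrete logarithm of a nonzero element (some exponent, not normalised).
  log : ∀ x → ¬ x ≈ 0# → ℕ
  log x x≉0 = proj₁ (θ-primitive x x≉0)

  θ^log : ∀ x (x≉0 : ¬ x ≈ 0#) → θ^ log x x≉0 ≈ x
  θ^log x x≉0 = proj₂ (θ-primitive x x≉0)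

  θ^-cancel : ∀ {j k s} → θ^ (j ℕ.+ k) ≈ θ^ j * s → θ^ k ≈ s
  θ^-cancel {j} {k} eq = *-cancelˡ (θ^-≉0 j) (trans (sym (pow-+ θ j k)) eq)

  -- The exponents k with θ^k in a multiplicative subgroup S of K (given by
  -- its closure properties) are the multiples of a period.
  module Exponents {s} (S : Carrier → Set s) (S? : ∀ x → Dec (S x))
    (S-resp : ∀ {x y} → x ≈ y → S x → S y) (S-1 : S 1#)
    (S-* : ∀ {x y} → S x → S y → S (x * y))
    (S-cancel : ∀ {x y} → ¬ x ≈ 0# → S x → S (x * y) → S y)
    {e} .{{_ : NonZero e}} (S-θ^e : S (θ^ e)) where

    open ExponentSet (λ k → S (θ^ k)) (S? ∘ θ^_) S-1
      (λ {a} {b} Sa Sb → S-resp (sym (pow-+ θ a b)) (S-* Sa Sb))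
      (λ {a} {b} Sab Sa → S-cancel (θ^-≉0 a) Sa (S-resp (pow-+ θ a b) Sab))
      using (Generator; generator)
    open Generator (generator S-θ^e) public

    instance
      period-nonZero : NonZero period
      period-nonZero = period≢0

    reduce : ∀ {d} .{{_ : NonZero d}} → period ∣ d → ∀ k → ∃ λ s → S s × θ^ k ≈ θ^ (k ℕ.% d) * s
    reduce {d} period∣d k = θ^ (k ℕ./ d ℕ.* d) , multiple∈P (∣-trans period∣d (n∣m*n (k ℕ./ d))) ,
      trans (reflexive (≡.cong θ^_ (m≡m%n+[m/n]*n k d))) (pow-+ θ (k ℕ.% d) (k ℕ./ d ℕ.* d))

    quotient∈S : ∀ {i j} → j ℕ.≤ i → θ^ i ≈ θ^ j → S (θ^ (i ℕ.∸ j))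
    quotient∈S {i} {j} j≤i θ^i≈θ^j = S-resp (sym (θ^-cancel {j} {i ℕ.∸ j} (begin
      θ^ (j ℕ.+ (i ℕ.∸ j)) ≡⟨ ≡.cong θ^_ (m+[n∸m]≡n j≤i) ⟩
      θ^ i                 ≈⟨ θ^i≈θ^j ⟩
      θ^ j                 ≈⟨ *-identityʳ _ ⟨
      θ^ j * 1#            ∎))) S-1

    congruent : ∀ {d} .{{_ : NonZero d}} → d ∣ period → ∀ {i j} → θ^ i ≈ θ^ j → i ℕ.% d ≡ j ℕ.% d
    congruent d∣period {i} {j} θ^i≈θ^j with ≤-total j i
    ... | inj₁ j≤i = %-congruent j≤i (∣-trans d∣period (period-divides (quotient∈S j≤i θ^i≈θ^j)))
    ... | inj₂ i≤j = ≡.sym (%-congruent i≤j (∣-trans d∣period (period-divides (quotient∈S i≤j (sym θ^i≈θ^j)))))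

  -- Some positive power of θ is 1: by pigeonhole two of θ^0, …, θ^M coincide.
  θ^-returns : ∃ λ e → θ^ suc e ≈ 1#
  θ^-returns with pigeonhole (n<1+n M) (λ i → index⁺ (θ^ toℕ i) (θ^-≉0 (toℕ i)))
  ... | i , j , i<j , same-index with m≤n⇒∃[o]m+o≡n i<j
  ...   | e , 1+i+e≡j = e , θ^-cancel {toℕ i} (begin
    θ^ (toℕ i ℕ.+ suc e) ≡⟨ ≡.cong θ^_ (≡.trans (+-suc (toℕ i) e) 1+i+e≡j) ⟩
    θ^ toℕ j             ≈⟨ index⁺-injective (θ^-≉0 (toℕ i)) (θ^-≉0 (toℕ j)) same-index ⟨
    θ^ toℕ i             ≈⟨ *-identityʳ _ ⟨
    θ^ toℕ i * 1#        ∎)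

  module Order = Exponents (_≈ 1#) (_≟ 1#) (λ x≈y x≈1 → trans (sym x≈y) x≈1) refl
    (λ x≈1 y≈1 → trans (*-cong x≈1 y≈1) (*-identityˡ 1#))
    (λ {x} {y} _ x≈1 xy≈1 → trans (sym (trans (*-congʳ x≈1) (*-identityˡ y))) xy≈1)
    {suc (proj₁ θ^-returns)} (proj₂ θ^-returns)

  θ^-mod : ∀ {d} .{{_ : NonZero d}} → Order.period ∣ d → ∀ k → θ^ k ≈ θ^ (k ℕ.% d)
  θ^-mod order∣d k with Order.reduce order∣d k
  ... | s , s≈1 , θ^k≈ = trans θ^k≈ (trans (*-congˡ s≈1) (*-identityʳ _))

  -- The order of a primitive element is M: θ^0, …, θ^(order-1) are distinct
  -- nonzero elements, and x ↦ log x mod order is injective on nonzero elements.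
  order≡M : Order.period ≡ M
  order≡M = ≤-antisym (nonzero-count-≥ powers (λ i → θ^-≉0 (toℕ i)) powers-injective)
                      (nonzero-count-≤ log-mod log-mod-injective)
    where
    powers : Fin Order.period → Carrier
    powers i = θ^ toℕ i

    powers-injective : ∀ {i j} → powers i ≈ powers j → i ≡ j
    powers-injective {i} {j} eq = toℕ-injective
      (≡.trans (≡.sym (m<n⇒m%n≡m (toℕ<n i))) (≡.trans (Order.congruent ∣-refl eq) (m<n⇒m%n≡m (toℕ<n j))))

    log-mod : ∀ x → ¬ x ≈ 0# → Fin Order.period
    log-mod x x≉0 = fromℕ< (m%n<n (log x x≉0) Order.period)

    log-mod-injective : ∀ {x y} x≉0 y≉0 → log-mod x x≉0 ≡ log-mod y y≉0 → x ≈ y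
    log-mod-injective {x} {y} x≉0 y≉0 eq = begin
      x                                      ≈⟨ θ^log x x≉0 ⟨
      θ^ log x x≉0                           ≈⟨ θ^-mod ∣-refl (log x x≉0) ⟩
      θ^ (log x x≉0 ℕ.% Order.period)        ≡⟨ ≡.cong θ^_ (fromℕ<-injective _ _ (m%n<n _ _) (m%n<n _ _) eq) ⟩
      θ^ (log y y≉0 ℕ.% Order.period)        ≈⟨ θ^-mod ∣-refl (log y y≉0) ⟨
      θ^ log y y≉0                           ≈⟨ θ^log y y≉0 ⟩
      y                                      ∎

  instance
    M-nonZero : NonZero M
    M-nonZero = ℕ.>-nonZero (<⇒≤ 1<M)

  θ^M≈1 : θ^ M ≈ 1#
  θ^M≈1 = Order.multiple∈P (∣-reflexive order≡M)

module Subfield {c₁ ℓ₁ c₂ ℓ₂}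
  (F : CommutativeRing c₁ ℓ₁) (F-field : IsField F) {q' : ℕ} .{{_ : NonZero q'}} (F-card : HasCard F (suc q'))
  (K : CommutativeRing c₂ ℓ₂) (K-field : IsField K) {n : ℕ} (1<n : 1 ℕ.< n) (K-card : HasCard K (suc (q' ℕ.* n)))
  (ι : CommutativeRing.Carrier F → CommutativeRing.Carrier K) (ι-embedding : IsEmbedding F K ι)
  (θ : CommutativeRing.Carrier K) (θ-primitive : IsPrimitive K θ) where

  private
    module F = CommutativeRing F
    module FF = FiniteRing F F-card
    module FL = FieldLaws F F-field
    module KF = FiniteRing K K-card
  open import Data.Nat.Properties using (<⇒≱; <⇒≤; m≤n*m; <-≤-trans; m*n≢0⇒m≢0; ≤-antisym; *-cancelˡ-≡)
  open CommutativeRing K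
  open RingMorphisms.IsRingMonomorphism ι-embedding
  open import Relation.Binary.Reasoning.Setoid setoid

  M : ℕ
  M = q' ℕ.* n

  open PrimitiveElement K K-field K-card (<-≤-trans 1<n (m≤n*m n q')) θ θ-primitive public

  ι-≉0 : ∀ {a} → ¬ a F.≈ F.0# → ¬ ι a ≈ 0#
  ι-≉0 a≉0 ιa≈0 = a≉0 (injective (trans ιa≈0 (sym 0#-homo)))

  ι-homo-sub : ∀ a b → ι (a F.- b) ≈ ι a - ι b
  ι-homo-sub a b = trans (+-homo a (F.- b)) (+-congˡ (-‿homo b))

  InF : Carrier → Set (c₁ ⊔ ℓ₂)
  InF x = ∃ λ a → x ≈ ι a

  InF? : ∀ x → Dec (InF x)
  InF? x = FF.any-element? (λ a → x ≈ ι a) (λ a≈b x≈ιa → trans x≈ιa (⟦⟧-cong a≈b)) (λ a → x KF.≟ ι a)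

  InF-resp : ∀ {x y} → x ≈ y → InF x → InF y
  InF-resp x≈y (a , x≈ιa) = a , trans (sym x≈y) x≈ιa

  InF-1 : InF 1#
  InF-1 = F.1# , sym 1#-homo

  InF-* : ∀ {x y} → InF x → InF y → InF (x * y)
  InF-* (a , x≈ιa) (b , y≈ιb) = a F.* b , trans (*-cong x≈ιa y≈ιb) (sym (*-homo a b))

  InF-cancel : ∀ {x y} → ¬ x ≈ 0# → InF x → InF (x * y) → InF y
  InF-cancel {x} {y} x≉0 (a , x≈ιa) (b , xy≈ιb) = b F.* a⁻¹ , (begin
    y                    ≈⟨ *-identityʳ y ⟨
    y * 1#               ≈⟨ *-congˡ (trans (sym 1#-homo) (trans (⟦⟧-cong (F.sym aa⁻¹≈1)) (*-homo a a⁻¹))) ⟩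
    y * (ι a * ι a⁻¹)    ≈⟨ *-assoc y (ι a) (ι a⁻¹) ⟨
    (y * ι a) * ι a⁻¹    ≈⟨ *-congʳ (trans (*-comm y (ι a)) (*-congʳ (sym x≈ιa))) ⟩
    (x * y) * ι a⁻¹      ≈⟨ *-congʳ xy≈ιb ⟩
    ι b * ι a⁻¹          ≈⟨ *-homo b a⁻¹ ⟨
    ι (b F.* a⁻¹)        ∎)
    where
    a≉0 : ¬ a F.≈ F.0#
    a≉0 a≈0 = x≉0 (trans x≈ιa (trans (⟦⟧-cong a≈0) 0#-homo))
    a⁻¹ : F.Carrier
    a⁻¹ = proj₁ (FL.inverse a a≉0)
    aa⁻¹≈1 : a F.* a⁻¹ F.≈ F.1#
    aa⁻¹≈1 = proj₂ (FL.inverse a a≉0)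

  θ^M∈F : InF (θ^ M)
  θ^M∈F = F.1# , trans θ^M≈1 (sym 1#-homo)

  module Index = Exponents InF InF? InF-resp InF-1 InF-* InF-cancel {M} θ^M∈F

  -- Counting ι(F)* when M = t·d for the period d: the elements of ι(F)* are
  -- exactly the t distinct powers θ^(j·d), j < t, so t = q'.
  module CountUnits {t : ℕ} (M≡t*d : M ≡ t ℕ.* Index.period) where
    d : ℕ
    d = Index.period

    instance
      td≢0 : NonZero (t ℕ.* d)
      td≢0 = ≡.subst NonZero M≡t*d M-nonZero
      t≢0 : NonZero t
      t≢0 = m*n≢0⇒m≢0 t {d} {{td≢0}}

    power : Fin t → F.Carrier
    power j = proj₁ (Index.multiple∈P (n∣m*n (toℕ j)))

    power-spec : ∀ j → θ^ (toℕ j ℕ.* d) ≈ ι (power j)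
    power-spec j = proj₂ (Index.multiple∈P (n∣m*n (toℕ j)))

    power-≉0 : ∀ j → ¬ power j F.≈ F.0#
    power-≉0 j a≈0 = θ^-≉0 (toℕ j ℕ.* d) (trans (power-spec j) (trans (⟦⟧-cong a≈0) 0#-homo))

    power-injective : ∀ {i j} → power i F.≈ power j → i ≡ j
    power-injective {i} {j} eq = toℕ-injective (multiples-injective (toℕ<n i) (toℕ<n j)
      (Order.congruent {t ℕ.* d} (∣-reflexive (≡.sym (≡.trans order≡M M≡t*d)))
        (trans (power-spec i) (trans (⟦⟧-cong eq) (sym (power-spec j))))))

    t≤q' : t ℕ.≤ q'
    t≤q' = FF.nonzero-count-≥ power power-≉0 power-injective

    log-ι-divisible : ∀ a (a≉0 : ¬ a F.≈ F.0#) → d ∣ log (ι a) (ι-≉0 a≉0)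
    log-ι-divisible a a≉0 = Index.period-divides {log (ι a) (ι-≉0 a≉0)} (a , θ^log (ι a) (ι-≉0 a≉0))

    exponent : ∀ a → ¬ a F.≈ F.0# → ℕ
    exponent a a≉0 = _∣_.quotient (log-ι-divisible a a≉0)

    ι-as-power : ∀ a a≉0 → ι a ≈ θ^ (exponent a a≉0 ℕ.% t ℕ.* d)
    ι-as-power a a≉0 = begin
      ι a                                     ≈⟨ θ^log (ι a) (ι-≉0 a≉0) ⟨
      θ^ log (ι a) (ι-≉0 a≉0)                 ≡⟨ ≡.cong θ^_ (_∣_.equality (log-ι-divisible a a≉0)) ⟩
      θ^ (exponent a a≉0 ℕ.* d)               ≈⟨ θ^-mod {t ℕ.* d} (∣-reflexive (≡.trans order≡M M≡t*d)) _ ⟩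
      θ^ (exponent a a≉0 ℕ.* d ℕ.% (t ℕ.* d)) ≡⟨ ≡.cong θ^_ (m%n*o≡m*o%[n*o] (exponent a a≉0) t d) ⟨
      θ^ (exponent a a≉0 ℕ.% t ℕ.* d)         ∎

    q'≤t : q' ℕ.≤ t
    q'≤t = FF.nonzero-count-≤ (λ a a≉0 → fromℕ< (m%n<n (exponent a a≉0) t)) λ {a} {b} a≉0 b≉0 eq →
      injective (trans (ι-as-power a a≉0) (trans (reflexive (≡.cong (λ r → θ^ (r ℕ.* d))
        (fromℕ<-injective _ _ (m%n<n (exponent a a≉0) t) (m%n<n (exponent b b≉0) t) eq)))
        (sym (ι-as-power b b≉0))))

  M≡q'*period : M ≡ q' ℕ.* Index.period
  M≡q'*period = count (Index.period-divides θ^M∈F)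
    where
    count : Index.period ∣ M → M ≡ q' ℕ.* Index.period
    count (divides t M≡t*d) = ≡.trans M≡t*d (≡.cong (ℕ._* Index.period) (≤-antisym t≤q' q'≤t))
      where open CountUnits {t} M≡t*d using (t≤q'; q'≤t)

  period≡n : Index.period ≡ n
  period≡n = *-cancelˡ-≡ Index.period n q' (≡.sym M≡q'*period)

  -- θ ∉ ι(F): otherwise the period would divide 1, whereas it is n > 1.
  θ∉F : ∀ a → ¬ θ ≈ ι a
  θ∉F a θ≈ιa = <⇒≱ 1<n (≡.subst (ℕ._≤ 1) period≡n
    (∣⇒≤ (Index.period-divides (a , trans (*-identityʳ θ) θ≈ιa))))

  θ-independent : ∀ c e → θ * ι c ≈ ι e → c F.≈ F.0#
  θ-independent c e θιc≈ιe = decide (c FF.≟ F.0#)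
    where
    θ∈F : ∀ {c⁻¹} → c F.* c⁻¹ F.≈ F.1# → θ ≈ ι (e F.* c⁻¹)
    θ∈F {c⁻¹} cc⁻¹≈1 = begin
      θ                      ≈⟨ *-identityʳ θ ⟨
      θ * 1#                 ≈⟨ *-congˡ (trans (sym 1#-homo) (trans (⟦⟧-cong (F.sym cc⁻¹≈1)) (*-homo c c⁻¹))) ⟩
      θ * (ι c * ι c⁻¹)      ≈⟨ *-assoc θ (ι c) (ι c⁻¹) ⟨
      (θ * ι c) * ι c⁻¹      ≈⟨ *-congʳ θιc≈ιe ⟩
      ι e * ι c⁻¹            ≈⟨ *-homo e c⁻¹ ⟨
      ι (e F.* c⁻¹)          ∎
    decide : Dec (c F.≈ F.0#) → c F.≈ F.0#
    decide (yes c≈0) = c≈0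
    decide (no  c≉0) = ⊥-elim (θ∉F _ (θ∈F (proj₂ (FL.inverse c c≉0))))

  coordinates : ∀ {c e c' e'} → θ * ι c + ι e ≈ θ * ι c' + ι e' → c F.≈ c' × e F.≈ e'
  coordinates {c} {e} {c'} {e'} eq = c≈c' , injective (+-cancelˡ (θ * ι c) (ι e) (ι e')
      (trans eq (+-congʳ (*-congˡ (⟦⟧-cong (F.sym c≈c'))))))
    where
    open import Algebra.Properties.Group F.+-group using (x∙y⁻¹≈ε⇒x≈y)
    open import Algebra.Properties.RingWithoutOne (Ring.ringWithoutOne ring) using (x[y-z]≈xy-xz; +-cancelˡ)
    open RingLaws K using (+≈+⇒-≈-)
    c≈c' : c F.≈ c'
    c≈c' = x∙y⁻¹≈ε⇒x≈y c c' (θ-independent (c F.- c') (e' F.- e) (begin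
      θ * ι (c F.- c')          ≈⟨ *-congˡ (ι-homo-sub c c') ⟩
      θ * (ι c - ι c')          ≈⟨ x[y-z]≈xy-xz θ (ι c) (ι c') ⟩
      θ * ι c - θ * ι c'        ≈⟨ +≈+⇒-≈- eq ⟩
      ι e' - ι e                ≈⟨ ι-homo-sub e' e ⟨
      ι (e' F.- e)              ∎))

  expand : ∀ a c → (θ + ι a) * ι c ≈ θ * ι c + ι (a F.* c)
  expand a c = trans (distribʳ (ι c) θ (ι a)) (+-congˡ (sym (*-homo a c)))

  affine-injective : ∀ {a b c c'} → ¬ c F.≈ F.0# → (θ + ι a) * ι c ≈ (θ + ι b) * ι c' → a F.≈ b
  affine-injective {a} {b} {c} {c'} c≉0 eq = conclude (coordinates (trans (sym (expand a c)) (trans eq (expand b c'))))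
    where
    conclude : c F.≈ c' × a F.* c F.≈ b F.* c' → a F.≈ b
    conclude (c≈c' , ac≈bc') = FL.*-cancelˡ c≉0
      (F.trans (F.*-comm c a) (F.trans ac≈bc' (F.trans (F.*-congˡ (F.sym c≈c')) (F.*-comm b c))))

  θ+ι∉F : ∀ a b → ¬ θ + ι a ≈ ι b
  θ+ι∉F a b eq = θ∉F (b F.- a) (begin
    θ                 ≈⟨ //-rightDividesʳ (ι a) θ ⟨
    (θ + ι a) - ι a   ≈⟨ +-congʳ eq ⟩
    ι b - ι a         ≈⟨ ι-homo-sub b a ⟨
    ι (b F.- a)       ∎)
    where open import Algebra.Properties.Group +-group using (//-rightDividesʳ)

  θ+ι≉0 : ∀ a → ¬ θ + ι a ≈ 0#
  θ+ι≉0 a eq = θ+ι∉F a F.0# (trans eq (sym 0#-homo))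

  singerLog : F.Carrier → ℕ
  singerLog a = log (θ + ι a) (θ+ι≉0 a)

  instance
    n≢0 : NonZero n
    n≢0 = ℕ.>-nonZero (<⇒≤ 1<n)

  singer-reduce : ∀ a → ∃ λ c → θ + ι a ≈ θ^ (singerLog a ℕ.% n) * ι c
  singer-reduce a = in-F (Index.reduce (∣-reflexive period≡n) (singerLog a))
    where
    in-F : (∃ λ s → InF s × θ^ singerLog a ≈ θ^ (singerLog a ℕ.% n) * s) →
           ∃ λ c → θ + ι a ≈ θ^ (singerLog a ℕ.% n) * ι c
    in-F (s , (c , s≈ιc) , θ^k≈) = c , trans (sym (θ^log _ (θ+ι≉0 a))) (trans θ^k≈ (*-congˡ s≈ιc))

  residue≢0 : ∀ a → singerLog a ℕ.% n ≢ 0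
  residue≢0 a r≡0 = in-F (singer-reduce a)
    where
    in-F : ¬ ∃ λ c → θ + ι a ≈ θ^ (singerLog a ℕ.% n) * ι c
    in-F (c , eq) = θ+ι∉F a c (trans eq (trans (*-congʳ (reflexive (≡.cong θ^_ r≡0))) (*-identityˡ (ι c))))

  residue-injective : ∀ {a b} → singerLog a ℕ.% n ≡ singerLog b ℕ.% n → a F.≈ b
  residue-injective {a} {b} r≡r' = compare (singer-reduce a) (singer-reduce b)
    where
    r r' : ℕ
    r  = singerLog a ℕ.% n
    r' = singerLog b ℕ.% n
    compare : (∃ λ c → θ + ι a ≈ θ^ r * ι c) → (∃ λ c' → θ + ι b ≈ θ^ r' * ι c') → a F.≈ b
    compare (c , θ+ιa≈) (c' , θ+ιb≈) = affine-injective c'≉0 (begin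
      (θ + ι a) * ι c'            ≈⟨ *-congʳ θ+ιa≈ ⟩
      (θ^ r * ι c) * ι c'         ≈⟨ *-assoc (θ^ r) (ι c) (ι c') ⟩
      θ^ r * (ι c * ι c')         ≈⟨ *-congˡ (*-comm (ι c) (ι c')) ⟩
      θ^ r * (ι c' * ι c)         ≈⟨ *-assoc (θ^ r) (ι c') (ι c) ⟨
      (θ^ r * ι c') * ι c         ≡⟨ ≡.cong (λ k → (θ^ k * ι c') * ι c) r≡r' ⟩
      (θ^ r' * ι c') * ι c        ≈⟨ *-congʳ θ+ιb≈ ⟨
      (θ + ι b) * ι c             ∎)
      where
      c'≉0 : ¬ c' F.≈ F.0#
      c'≉0 c'≈0 = θ+ι≉0 b (trans θ+ιb≈ (trans (*-congˡ (trans (⟦⟧-cong c'≈0) 0#-homo)) (zeroʳ _)))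

  residue-congruent : ∀ {k a} → θ^ k ≈ θ + ι a → k ℕ.% n ≡ singerLog a ℕ.% n
  residue-congruent {a = a} eq = Index.congruent (∣-reflexive (≡.sym period≡n)) (trans eq (sym (θ^log _ (θ+ι≉0 a))))

  singerLog-cong : ∀ {a b} → a F.≈ b → singerLog a ℕ.% n ≡ singerLog b ℕ.% n
  singerLog-cong {a} {b} a≈b = residue-congruent (trans (θ^log _ (θ+ι≉0 a)) (+-congˡ (⟦⟧-cong a≈b)))

cube : ∀ q' → suc q' ^ 3 ≡ suc (q' ℕ.* modulus (suc q'))
cube = identity
  where
  identity : ∀ q' → suc q' ℕ.* (suc q' ℕ.* (suc q' ℕ.* 1)) ≡ suc (q' ℕ.* suc (suc q' ℕ.* suc q' ℕ.+ suc q'))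
  identity = solve-∀

module AbsolutePoints {c ℓ c' ℓ'} (q' : ℕ) .{{_ : ℕ.NonZero q'}}
  (F : CommutativeRing c ℓ) (F-field : IsField F) (F-card : HasCard F (suc q'))
  (K : CommutativeRing c' ℓ') (K-field : IsField K) (K-card : HasCard K (suc q' ^ 3))
  (ι : CommutativeRing.Carrier F → CommutativeRing.Carrier K) (ι-embedding : IsEmbedding F K ι)
  (θ : CommutativeRing.Carrier K) (θ-primitive : IsPrimitive K θ) where

  open import Data.Fin using (zero; suc)
  open ≡ using (refl; sym; trans; cong)

  q n : ℕ
  q = suc q'
  n = modulus q

  1<n : 1 ℕ.< n
  1<n = ℕ.s≤s (ℕ.s≤s ℕ.z≤n)

  open Subfield F F-field F-card K K-field 1<n (≡.subst (HasCard K) (cube q') K-card) ι ι-embedding θ θ-primitive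
  open Halving (q ℕ.* q ℕ.+ q) (triangle q) (triangle-double q)
  private
    module F = CommutativeRing F
    module FF = FiniteRing F F-card

  G₀ : Fin n → Set (c ⊔ ℓ')
  G₀ = SingerG0 q F K ι θ

  singerPoint : Fin (suc q) → Fin n
  singerPoint zero    = zero
  singerPoint (suc i) = fromℕ< (m%n<n (singerLog (FF.element i)) n)

  singerPoint-injective : Injective _≡_ _≡_ singerPoint
  singerPoint-injective {zero}  {zero}  _  = refl
  singerPoint-injective {zero}  {suc j} eq = ⊥-elim (residue≢0 _ (trans (sym (toℕ-fromℕ< _)) (sym (cong toℕ eq))))
  singerPoint-injective {suc i} {zero}  eq = ⊥-elim (residue≢0 _ (trans (sym (toℕ-fromℕ< _)) (cong toℕ eq)))
  singerPoint-injective {suc i} {suc j} eq = cong suc (FF.element-injective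
    (residue-injective {FF.element i} {FF.element j}
      (fromℕ<-injective _ _ (m%n<n (singerLog (FF.element i)) n) (m%n<n (singerLog (FF.element j)) n) eq)))

  G₀-enumerated : ∀ r → G₀ r ⇔ ∃ λ i → singerPoint i ≡ r
  G₀-enumerated r = mk⇔ enumerate member
    where
    enumerate : G₀ r → ∃ λ i → singerPoint i ≡ r
    enumerate (inj₁ r≡0) = zero , toℕ-injective (sym r≡0)
    enumerate (inj₂ (a , k , θ^k≈θ+ιa , k%n≡r)) = suc (FF.index a) , toℕ-injective (begin
      toℕ (fromℕ< (m%n<n (singerLog (FF.element (FF.index a))) n)) ≡⟨ toℕ-fromℕ< _ ⟩
      singerLog (FF.element (FF.index a)) ℕ.% n                     ≡⟨ singerLog-cong (FF.element-index a) ⟩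
      singerLog a ℕ.% n                                             ≡⟨ residue-congruent {k} θ^k≈θ+ιa ⟨
      k ℕ.% n                                                       ≡⟨ k%n≡r ⟩
      toℕ r                                                         ∎)
      where open ≡.≡-Reasoning
    member : (∃ λ i → singerPoint i ≡ r) → G₀ r
    member (zero  , refl) = inj₁ refl
    member (suc i , refl) = inj₂ (FF.element i , singerLog (FF.element i) ,
                                  θ^log _ (θ+ι≉0 (FF.element i)) , sym (toℕ-fromℕ< _))

  absolutePoint : Fin (suc q) → Fin n
  absolutePoint = half ∘ singerPoint

  absolutePoint-injective : Injective _≡_ _≡_ absolutePoint
  absolutePoint-injective {i} {j} eq =
    singerPoint-injective (trans (sym (double-half _)) (trans (cong double eq) (double-half _)))

  isAbsolute⇔ : ∀ z → z ∈ image absolutePoint ⇔ IsAbsolute G₀ z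
  isAbsolute⇔ z = ⇔.trans (image-isImage absolutePoint z) (⇔.trans (mk⇔
    (λ (i , h≡z) → i , trans (sym (double-half _)) (cong double h≡z))
    (λ (i , s≡2z) → i , trans (cong half s≡2z) (half-double z)))
    (⇔.sym (G₀-enumerated (double z))))

  absolute-vertices : Σ (Subset n) λ P → (∀ z → (z ∈ P) ⇔ IsAbsolute G₀ z) × ∣ P ∣ ≡ suc q
  absolute-vertices = image absolutePoint , isAbsolute⇔ ,
            ∣image∣ (image absolutePoint) absolutePoint absolutePoint-injective (image-isImage absolutePoint)

prime-power>1 : ∀ {q} → IsPrimePower q → 1 ℕ.< q
prime-power>1 (p , ℕ.suc k , p-prime , _ , ≡.refl) =
  <-≤-trans (nonTrivial⇒n>1 p) (m≤m*n p (p ℕ.^ k) {{m^n≢0 p k}})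
  where
  open import Data.Nat using (nonTrivial⇒n>1)
  open import Data.Nat.Properties using (<-≤-trans; m≤m*n; m^n≢0)
  open import Data.Nat.Primality using (prime⇒nonTrivial; prime⇒nonZero)
  instance
    p-nonTrivial : ℕ.NonTrivial p
    p-nonTrivial = prime⇒nonTrivial p-prime
    p-nonZero : NonZero p
    p-nonZero = prime⇒nonZero p-prime

mainTheorem8 : ∀ {c ℓ c' ℓ'} (q : ℕ) → IsPrimePower q →
    (F : CommutativeRing c ℓ) → IsField F → HasCard F q →
    (K : CommutativeRing c' ℓ') → IsField K → HasCard K (q ^ 3) →
    (ι : CommutativeRing.Carrier F → CommutativeRing.Carrier K) → IsEmbedding F K ι →
    (θ : CommutativeRing.Carrier K) → IsPrimitive K θ →
    Σ (Subset (modulus q)) λ P →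
      (∀ z → (z ∈ P) ⇔ IsAbsolute (SingerG0 q F K ι θ) z) × ∣ P ∣ ≡ suc q
mainTheorem8 (suc (suc q'')) _ = AbsolutePoints.absolute-vertices (suc q'')
mainTheorem8 ℕ.zero          q-pp = contradiction (prime-power>1 q-pp) λ ()
mainTheorem8 (suc ℕ.zero)    q-pp = contradiction (prime-power>1 q-pp) λ { (ℕ.s≤s ()) }
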